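{- Let $b\ge2$ and $q\ge 3$ be integers with $2q\le b/\ln b$, and let $T$ be a complete $b$-ary tree. Let $v$ be a vertex of $T$ with $h(v)\geq 1$ and let $\ell$ be a leaf that is a descendant of $v$. Let $\Psi_{v,\ell}$ be the probability that $v$ is $\ell$-loose in $x$ when $x$ is a uniformly random proper $q$-colouring of $T$. Then $\Psi_{v,\ell}\leq \varepsilon$, where $\varepsilon=(q-1)\exp\!\left(-\frac{b-2}{q-1}\right)$.
   Context: The complete $b$-ary tree of height $H$ has a root, every non-leaf vertex has $b$ children and every root-to-leaf path has $H$ edges. The height $h(v)$ of a vertex is the number of edges on a path from $v$ down to a leaf. For a vertex $w$, $T_w$ is the subtree rooted at $w$ and $L(T_w)$ its set of leaves. A proper $q$-colouring uses colours $[q]=\{0,\dots,q-1\}$ with adjacent vertices coloured differently; $\Omega(T_w)$ is the set of proper $q$-colourings of $T_w$ and $\Omega$ that of $T$. For $x\in\Omega$, $F(x)$ is the set of vertices $w$ such that every $y\in\Omega(T_w)$ with $y(L(T_w))=x(L(T_w))$ satisfies $y(w)=x(w)$. If $w$ is a child of $v$ and $c$ a colour, $w$ is $c$-permitting for $v$ in $x$ if $x(w)\ne c$ or $w\notin F(x)$ (or both). For $v$ with $h(v)\ge1$ and a leaf $\ell$ descending from $v$, $v$ is $\ell$-loose in $x$ if there is a colour $c\ne x(v)$ such that every child $w$ of $v$, except possibly the child on the path from $v$ to $\ell$, is $c$-permitting for $v$ in $x$. -}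

module Defs where

open import Data.Nat using (ℕ; zero; suc; _+_; _*_; _∸_; _^_; _≤_; _<_)
open import Data.Nat using (_!)
open import Data.Fin using (Fin)
open import Data.Vec using (Vec; []; _∷_; lookup; toList; head)
open import Data.Vec.Relation.Unary.All using (All)
open import Data.List using (List; [_]; concatMap)
open import Data.Product using (_×_; Σ; ∃; ∃-syntax; _,_)
open import Data.Sum using (_⊎_)
open import Data.Unit using (⊤)
open import Relation.Nullary using (¬_)
open import Relation.Binary.PropositionalEquality using (_≡_; _≢_)

-- A (not necessarily proper) colouring is stored as a tree-shaped value:
-- the colour of the root together with the colourings of the b subtrees
-- (children indexed by Fin b).  Vertices are thus addressed by paths
-- (vectors of child indices) from the root.

Col : (b q : ℕ) → ℕ → Set
Col b q zero    = Fin q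
Col b q (suc h) = Fin q × Vec (Col b q h) b

root : ∀ {b q} h → Col b q h → Fin q
root zero    c        = c
root (suc h) (c , ts) = c

Proper : ∀ {b q} h → Col b q h → Set
Proper zero    c        = ⊤
Proper (suc h) (c , ts) = All (λ t → (root _ t ≢ c) × Proper _ t) ts

leaves : ∀ {b q} h → Col b q h → List (Fin q)
leaves zero    c        = [ c ]
leaves (suc h) (c , ts) = concatMap (leaves h) (toList ts)

-- the colouring restricted to the subtree T_w, where w is the vertex at
-- path p (of depth d) from the root
subAt : ∀ {b q k} d → Vec (Fin b) d → Col b q (d + k) → Col b q k
subAt zero    []      t        = t
subAt (suc d) (i ∷ p) (c , ts) = subAt d p (lookup ts i)

-- w ∈ F(x), phrased for t = x restricted to T_w: every proper colouring y
-- of T_w agreeing with t on the leaves of T_w has y(w) = t(w)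
Forced : ∀ {b q} h → Col b q h → Set
Forced {b} {q} h t =
  (y : Col b q h) → Proper h y → leaves h y ≡ leaves h t → root h y ≡ root h t

Permitting : ∀ {b q} h → Fin q → Col b q h → Set
Permitting h c t = (root h t ≢ c) ⊎ (¬ Forced h t)

-- s = x restricted to T_v with h(v) = suc h ≥ 1; ℓ = path from v down to
-- a leaf ℓ of T_v (its first entry is the child of v on the path to ℓ).
-- v is ℓ-loose: ∃ c ≠ x(v) with every child w of v, except possibly the
-- child on the path to ℓ, being c-permitting.
Loose : ∀ {b q} h → Col b q (suc h) → Vec (Fin b) (suc h) → Set
Loose {b} {q} h (c₀ , ts) ℓ =
  Σ (Fin q) λ c → (c ≢ c₀) ×
    ((i : Fin b) → i ≢ head ℓ → Permitting h c (lookup ts i))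

-- Comparisons with powers of e, without real numbers.
-- expPS k n = n! * Σ_{j ≤ n} k^j / j!   (an integer), i.e. the n-th
-- partial sum of the exponential series of e^k, scaled by n!.
expPS : ℕ → ℕ → ℕ
expPS k zero    = 1
expPS k (suc n) = suc n * expPS k n + k ^ suc n

-- B · e^k ≤ A   (all partial sums of B·e^k are ≤ A; the partial sums
-- increase to B·e^k)
infix 4 _·e^_≤_
_·e^_≤_ : ℕ → ℕ → ℕ → Set
B ·e^ k ≤ A = ∀ n → B * expPS k n ≤ A * (n !)

-- N ≤ e^k   (sup of the partial sums is ≥ N: for every d ≥ 1 some partial
-- sum is ≥ N - 1/d)
infix 4 _≤e^_
_≤e^_ : ℕ → ℕ → Set
N ≤e^ k = ∀ d → 0 < d → ∃[ n ] ((N * d ∸ 1) * (n !) ≤ d * expPS k n)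

{-# OPTIONS --safe #-}
-- Let P_h = ((q - 1) P_{h-1})^b be the number of proper colourings of a subtree of height h
-- with a given root colour.  The root of such a colouring can be unforced only if, for some
-- colour c′ other than its own, every child is c′-permitting.  Counting these colourings, an
-- induction on h shows that at most a 1/(b - 1) fraction of them is unforced, as long as
-- D Kᵇ ≤ Dᵇ for D = (b - 1)(q - 1) and K = D - (b - 2), which follows from b^(2q) ≤ eᵇ.  So a
-- child of a vertex coloured c is c′-permitting in at most a K / D fraction of the colourings,
-- and v is ℓ-loose in at most a (q - 1)(K / D)^(b-1) fraction of the colourings of T_v; fixing
-- the colouring outside T_v does not change this.  Finally
-- (K / D)^((b-1)(q-1)) = (K / D)^D ≤ e^-(b-2), because (1 + k / K)^(K + k) ≥ eᵏ.
module Submission where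

open import Defs
open import Data.Nat using (ℕ; zero; suc; _+_; _*_; _∸_; _^_; _≤_; _<_; _!; z≤n; s≤s; s≤s⁻¹; _≤?_; NonZero; >-nonZero; >-nonZero⁻¹)
open import Data.Nat.Properties
open import Data.Nat.Tactic.RingSolver using (solve-∀)
open import Data.Fin using (Fin; zero; suc; punchIn; punchOut)
import Data.Fin.Properties as Finₚ
open import Data.Fin.Properties using (punchIn-punchOut; punchInᵢ≢i; punchIn-injective)
open import Data.Vec using (Vec; []; _∷_; lookup; toList; head)
import Data.Vec.Properties as Vecₚ
open import Data.Vec.Relation.Unary.All.Properties using (lookup⁺; lookup⁻)
open import Data.Vec.Functional using (updateAt)
open import Data.Vec.Functional.Properties using (updateAt-updates; updateAt-minimal)
open import Data.List using (List; []; _∷_; _++_; map; length; [_]; concatMap; cartesianProductWith)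
open import Data.List.Properties using (length-++; length-map; ∷-injectiveˡ; ∷-injectiveʳ)
import Data.List.Membership.DecPropositional as DecMembership
open import Data.List.Membership.Propositional using (_∈_; _∉_)
open import Data.List.Membership.Propositional.Properties
  using (∈-++⁺ˡ; ∈-++⁺ʳ; ∈-++⁻; ∈-map⁺; ∈-map⁻; ∈-cartesianProductWith⁺; ∈-cartesianProductWith⁻)
open import Data.List.Relation.Unary.Any using (here; there)
open import Data.List.Relation.Unary.All as All using (All)
open import Data.List.Relation.Unary.AllPairs using ([]; _∷_)
open import Data.List.Relation.Unary.Unique.Propositional using (Unique)
open import Data.List.Relation.Unary.Unique.Propositional.Properties using (++⁺; map⁺; cartesianProductWith⁺)
open import Data.List.Relation.Binary.Subset.Propositional using (_⊆_)
import Data.Product.Properties as ×ₚ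
open import Data.Product using (_×_; _,_; proj₁; proj₂; swap; ∃-syntax)
open import Data.Sum using (_⊎_; inj₁; inj₂)
open import Data.Unit using (tt)
open import Data.Empty using (⊥)
open import Function using (_∘_; _$_; const)
open import Relation.Nullary using (¬_; yes; no; contradiction)
open import Relation.Nullary.Decidable using (from-no)
open import Relation.Binary.Definitions using (DecidableEquality)
open import Relation.Binary.PropositionalEquality hiding ([_])
import Algebra.Properties.CommutativeSemigroup as CommSemigroupₚ

private module +-CS = CommSemigroupₚ +-commutativeSemigroup
private module *-CS = CommSemigroupₚ *-commutativeSemigroup

private
  variable
    A B C : Set
    m : ℕ

∑ : (Fin m → ℕ) → ℕ
∑ {zero}  f = 0
∑ {suc m} f = f zero + ∑ (f ∘ suc)

∏ : (Fin m → ℕ) → ℕ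
∏ {zero}  f = 1
∏ {suc m} f = f zero * ∏ (f ∘ suc)

∑-cong : {f g : Fin m → ℕ} → (∀ i → f i ≡ g i) → ∑ f ≡ ∑ g
∑-cong {zero}  f≗g = refl
∑-cong {suc m} f≗g = cong₂ _+_ (f≗g zero) (∑-cong (f≗g ∘ suc))

∏-cong : {f g : Fin m → ℕ} → (∀ i → f i ≡ g i) → ∏ f ≡ ∏ g
∏-cong {zero}  f≗g = refl
∏-cong {suc m} f≗g = cong₂ _*_ (f≗g zero) (∏-cong (f≗g ∘ suc))

∑-mono-≤ : {f g : Fin m → ℕ} → (∀ i → f i ≤ g i) → ∑ f ≤ ∑ g
∑-mono-≤ {zero}  f≤g = z≤n
∑-mono-≤ {suc m} f≤g = +-mono-≤ (f≤g zero) (∑-mono-≤ (f≤g ∘ suc))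

∏-mono-≤ : {f g : Fin m → ℕ} → (∀ i → f i ≤ g i) → ∏ f ≤ ∏ g
∏-mono-≤ {zero}  f≤g = ≤-refl
∏-mono-≤ {suc m} f≤g = *-mono-≤ (f≤g zero) (∏-mono-≤ (f≤g ∘ suc))

∑-const : ∀ m a → ∑ {m} (const a) ≡ m * a
∑-const zero    a = refl
∑-const (suc m) a = cong (a +_) (∑-const m a)

∏-const : ∀ m a → ∏ {m} (const a) ≡ a ^ m
∏-const zero    a = refl
∏-const (suc m) a = cong (a *_) (∏-const m a)

∑-≤-except : ∀ (f : Fin (suc m) → ℕ) j {a b} →
             f j ≤ a → (∀ i → i ≢ j → f i ≤ b) → ∑ f ≤ a + m * b
∑-≤-except {m} f zero fj≤a fi≤b =
  +-mono-≤ fj≤a (≤-trans (∑-mono-≤ (λ i → fi≤b (suc i) λ ())) (≤-reflexive (∑-const m _)))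
∑-≤-except {suc m} f (suc j) {a} {b} fj≤a fi≤b = begin
  f zero + ∑ (f ∘ suc)
    ≤⟨ +-mono-≤ (fi≤b zero λ ()) (∑-≤-except (f ∘ suc) j fj≤a (λ i i≢j → fi≤b (suc i) (i≢j ∘ Finₚ.suc-injective))) ⟩
  b + (a + m * b)      ≡⟨ +-CS.x∙yz≈y∙xz b a (m * b) ⟩
  a + (b + m * b)      ∎
  where open ≤-Reasoning

∏-≤-except : ∀ (f : Fin (suc m) → ℕ) j {a b} →
             f j ≤ a → (∀ i → i ≢ j → f i ≤ b) → ∏ f ≤ a * b ^ m
∏-≤-except {m} f zero fj≤a fi≤b =
  *-mono-≤ fj≤a (≤-trans (∏-mono-≤ (λ i → fi≤b (suc i) λ ())) (≤-reflexive (∏-const m _)))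
∏-≤-except {suc m} f (suc j) {a} {b} fj≤a fi≤b = begin
  f zero * ∏ (f ∘ suc)
    ≤⟨ *-mono-≤ (fi≤b zero λ ()) (∏-≤-except (f ∘ suc) j fj≤a (λ i i≢j → fi≤b (suc i) (i≢j ∘ Finₚ.suc-injective))) ⟩
  b * (a * b ^ m)      ≡⟨ *-CS.x∙yz≈y∙xz b a (b ^ m) ⟩
  a * (b * b ^ m)      ∎
  where open ≤-Reasoning

-- x ≼ y states x / y ≤ num / den without division.
module Ratio (num den : ℕ) where

  infix 4 _≼_
  _≼_ : ℕ → ℕ → Set
  x ≼ y = x * den ≤ num * y

  ∑-≼ : {f g : Fin m → ℕ} → (∀ i → f i ≼ g i) → ∑ f ≼ ∑ g
  ∑-≼ {zero}  f≼g = z≤n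
  ∑-≼ {suc m} {f} {g} f≼g = begin
    (f zero + ∑ (f ∘ suc)) * den      ≡⟨ *-distribʳ-+ den (f zero) _ ⟩
    f zero * den + ∑ (f ∘ suc) * den  ≤⟨ +-mono-≤ (f≼g zero) (∑-≼ (f≼g ∘ suc)) ⟩
    num * g zero + num * ∑ (g ∘ suc)  ≡⟨ *-distribˡ-+ num (g zero) _ ⟨
    num * (g zero + ∑ (g ∘ suc))      ∎
    where open ≤-Reasoning

  ∏-≼-except : {f g : Fin m → ℕ} (j : Fin m) →
               f j ≼ g j → (∀ i → i ≢ j → f i ≡ g i) → ∏ f ≼ ∏ g
  ∏-≼-except {suc m} {f} {g} zero fj≼gj fi≡gi = begin
    f zero * ∏ (f ∘ suc) * den  ≡⟨ cong (λ x → f zero * x * den) (∏-cong (λ i → fi≡gi (suc i) λ ())) ⟩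
    f zero * ∏ (g ∘ suc) * den  ≡⟨ *-CS.xy∙z≈xz∙y (f zero) _ den ⟩
    f zero * den * ∏ (g ∘ suc)  ≤⟨ *-monoˡ-≤ (∏ (g ∘ suc)) fj≼gj ⟩
    num * g zero * ∏ (g ∘ suc)  ≡⟨ *-assoc num _ _ ⟩
    num * (g zero * ∏ (g ∘ suc)) ∎
    where open ≤-Reasoning
  ∏-≼-except {suc m} {f} {g} (suc j) fj≼gj fi≡gi = begin
    f zero * ∏ (f ∘ suc) * den     ≡⟨ *-assoc (f zero) _ den ⟩
    f zero * (∏ (f ∘ suc) * den)
      ≤⟨ *-monoʳ-≤ (f zero) (∏-≼-except j fj≼gj (λ i i≢j → fi≡gi (suc i) (i≢j ∘ Finₚ.suc-injective))) ⟩
    f zero * (num * ∏ (g ∘ suc))   ≡⟨ cong (_* (num * ∏ (g ∘ suc))) (fi≡gi zero λ ()) ⟩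
    g zero * (num * ∏ (g ∘ suc))   ≡⟨ *-CS.x∙yz≈y∙xz (g zero) num _ ⟩
    num * (g zero * ∏ (g ∘ suc))   ∎
    where open ≤-Reasoning

updateAt-elim : ∀ (P : A → Set) (xs : Fin m → A) i {y} j →
                (j ≡ i → P y) → (j ≢ i → P (xs j)) → P (updateAt xs i (const y) j)
updateAt-elim P xs i j Py Pxs with j Finₚ.≟ i
... | yes refl = subst P (sym (updateAt-updates i xs)) (Py refl)
... | no j≢i   = subst P (sym (updateAt-minimal j i xs j≢i)) (Pxs j≢i)

concatFin : (Fin m → List A) → List A
concatFin {m = zero}  xss = []
concatFin {m = suc m} xss = xss zero ++ concatFin (xss ∘ suc)

∈-concatFin⁺ : ∀ (xss : Fin m → List A) i {x} → x ∈ xss i → x ∈ concatFin xss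
∈-concatFin⁺ {m = suc m} xss zero    x∈ = ∈-++⁺ˡ x∈
∈-concatFin⁺ {m = suc m} xss (suc i) x∈ = ∈-++⁺ʳ (xss zero) (∈-concatFin⁺ (xss ∘ suc) i x∈)

∈-concatFin⁻ : ∀ (xss : Fin m → List A) {x} → x ∈ concatFin xss → ∃[ i ] x ∈ xss i
∈-concatFin⁻ {m = suc m} xss x∈ with ∈-++⁻ (xss zero) x∈
... | inj₁ x∈₀ = zero , x∈₀
... | inj₂ x∈ᵣ with ∈-concatFin⁻ (xss ∘ suc) x∈ᵣ
... | i , x∈ᵢ = suc i , x∈ᵢ

length-concatFin : ∀ (xss : Fin m → List A) → length (concatFin xss) ≡ ∑ (length ∘ xss)
length-concatFin {m = zero}  xss = refl
length-concatFin {m = suc m} xss =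
  trans (length-++ (xss zero)) (cong (length (xss zero) +_) (length-concatFin (xss ∘ suc)))

unique-concatFin : ∀ (xss : Fin m → List A) → (∀ i → Unique (xss i)) →
                   (∀ i j {x} → x ∈ xss i → x ∈ xss j → i ≡ j) → Unique (concatFin xss)
unique-concatFin {m = zero}  xss uniq disj = []
unique-concatFin {m = suc m} xss uniq disj =
  ++⁺ (uniq zero) (unique-concatFin (xss ∘ suc) (uniq ∘ suc) (λ i j x∈ x∈′ → Finₚ.suc-injective (disj _ _ x∈ x∈′)))
      (λ (x∈₀ , x∈ᵣ) → not-in-both (proj₂ (∈-concatFin⁻ (xss ∘ suc) x∈ᵣ)) x∈₀)
  where
  not-in-both : ∀ {x} {i} → x ∈ xss (suc i) → x ∈ xss zero → ⊥
  not-in-both x∈ x∈₀ with () ← disj zero _ x∈₀ x∈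

length-cartesianProductWith : ∀ (f : A → B → C) xs ys →
  length (cartesianProductWith f xs ys) ≡ length xs * length ys
length-cartesianProductWith f []       ys = refl
length-cartesianProductWith f (x ∷ xs) ys = begin
  length (map (f x) ys ++ cartesianProductWith f xs ys)
    ≡⟨ length-++ (map (f x) ys) ⟩
  length (map (f x) ys) + length (cartesianProductWith f xs ys)
    ≡⟨ cong₂ _+_ (length-map (f x) ys) (length-cartesianProductWith f xs ys) ⟩
  length ys + length xs * length ys
    ∎
  where open ≡-Reasoning

cartesian : (Fin m → List A) → List (Vec A m)
cartesian {m = zero}  xss = [ [] ]
cartesian {m = suc m} xss = cartesianProductWith _∷_ (xss zero) (cartesian (xss ∘ suc))

∈-cartesian⁺ : ∀ (xss : Fin m → List A) {v} → (∀ i → lookup v i ∈ xss i) → v ∈ cartesian xss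
∈-cartesian⁺ {m = zero}  xss {[]}    v∈ = here refl
∈-cartesian⁺ {m = suc m} xss {x ∷ v} v∈ =
  ∈-cartesianProductWith⁺ _∷_ (v∈ zero) (∈-cartesian⁺ (xss ∘ suc) (v∈ ∘ suc))

∈-cartesian⁻ : ∀ (xss : Fin m → List A) {v} → v ∈ cartesian xss → ∀ i → lookup v i ∈ xss i
∈-cartesian⁻ {m = suc m} xss v∈ i
  with _ , w , x∈ , w∈ , refl ← ∈-cartesianProductWith⁻ _∷_ (xss zero) (cartesian (xss ∘ suc)) v∈
  with i
... | zero  = x∈
... | suc i = ∈-cartesian⁻ (xss ∘ suc) w∈ i

unique-cartesian : ∀ (xss : Fin m → List A) → (∀ i → Unique (xss i)) → Unique (cartesian xss)
unique-cartesian {m = zero}  xss uniq = All.[] ∷ []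
unique-cartesian {m = suc m} xss uniq =
  cartesianProductWith⁺ _∷_ Vecₚ.∷-injective (uniq zero) (unique-cartesian (xss ∘ suc) (uniq ∘ suc))

length-cartesian : ∀ (xss : Fin m → List A) → length (cartesian xss) ≡ ∏ (length ∘ xss)
length-cartesian {m = zero}  xss = refl
length-cartesian {m = suc m} xss =
  trans (length-cartesianProductWith _∷_ (xss zero) _) (cong (length (xss zero) *_) (length-cartesian (xss ∘ suc)))

⊆-unique⇒length-≤ : ∀ {xs ys : List A} → Unique xs → xs ⊆ ys → length xs ≤ length ys
⊆-unique⇒length-≤ {xs = []}     uniq xs⊆ys = z≤n
⊆-unique⇒length-≤ {xs = x ∷ xs} {ys} (x∉xs ∷ uniq) xs⊆ys = begin
  suc (length xs)               ≤⟨ s≤s (⊆-unique⇒length-≤ uniq xs⊆ys−x) ⟩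
  suc (length (remove ys x∈ys)) ≡⟨ length-remove ys x∈ys ⟩
  length ys                     ∎
  where
  open ≤-Reasoning
  x∈ys : x ∈ ys
  x∈ys = xs⊆ys (here refl)
  remove : ∀ {x} (ys : List A) → x ∈ ys → List A
  remove (y ∷ ys) (here _)  = ys
  remove (y ∷ ys) (there p) = y ∷ remove ys p
  length-remove : ∀ {x} (ys : List A) (p : x ∈ ys) → suc (length (remove ys p)) ≡ length ys
  length-remove (y ∷ ys) (here _)  = refl
  length-remove (y ∷ ys) (there p) = cong suc (length-remove ys p)
  ∈-remove : ∀ {x z} (ys : List A) (p : x ∈ ys) → z ∈ ys → z ≢ x → z ∈ remove ys p
  ∈-remove (y ∷ ys) (here refl) (here refl) z≢x = contradiction refl z≢x
  ∈-remove (y ∷ ys) (here refl) (there z∈)  z≢x = z∈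
  ∈-remove (y ∷ ys) (there p)   (here refl) z≢x = here refl
  ∈-remove (y ∷ ys) (there p)   (there z∈)  z≢x = there (∈-remove ys p z∈ z≢x)
  xs⊆ys−x : xs ⊆ remove ys x∈ys
  xs⊆ys−x z∈ = ∈-remove ys x∈ys (xs⊆ys (there z∈)) (λ { refl → All.lookup x∉xs z∈ refl })

++-injective : ∀ (xs ys : List A) {zs ws} → length xs ≡ length ys →
               xs ++ zs ≡ ys ++ ws → xs ≡ ys × zs ≡ ws
++-injective []       []       _   eq = refl , eq
++-injective (x ∷ xs) (y ∷ ys) len eq
  with refl ← ∷-injectiveˡ eq
  with xs≡ys , zs≡ws ← ++-injective xs ys (suc-injective len) (∷-injectiveʳ eq) = cong (x ∷_) xs≡ys , zs≡ws

^-distrib-* : ∀ m n k → (m * n) ^ k ≡ m ^ k * n ^ k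
^-distrib-* m n zero    = refl
^-distrib-* m n (suc k) = begin
  m * n * (m * n) ^ k       ≡⟨ cong (m * n *_) (^-distrib-* m n k) ⟩
  m * n * (m ^ k * n ^ k)   ≡⟨ *-CS.interchange m n (m ^ k) (n ^ k) ⟩
  m * m ^ k * (n * n ^ k)   ∎
  where open ≡-Reasoning

^-comm : ∀ x m n → (x ^ m) ^ n ≡ (x ^ n) ^ m
^-comm x m n = begin
  (x ^ m) ^ n ≡⟨ ^-*-assoc x m n ⟩
  x ^ (m * n) ≡⟨ cong (x ^_) (*-comm m n) ⟩
  x ^ (n * m) ≡⟨ ^-*-assoc x n m ⟨
  (x ^ n) ^ m ∎
  where open ≡-Reasoning

^-cancelʳ-≤ : ∀ x y n .{{_ : NonZero n}} → x ^ n ≤ y ^ n → x ≤ y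
^-cancelʳ-≤ x y n xⁿ≤yⁿ = ≮⇒≥ λ y<x → <⇒≱ (^-monoˡ-< n y<x) xⁿ≤yⁿ

-- Comparisons with powers of e

≤e^-·e^≤⇒*≤ : ∀ N k B A → N ≤e^ k → B ·e^ k ≤ A → N * B ≤ A
≤e^-·e^≤⇒*≤ N k B A N≤eᵏ Beᵏ≤A = s≤s⁻¹ (*-cancelʳ-< d (N * B) (suc A) NBd<[1+A]d)
  where
  d : ℕ
  d = suc B
  open ≤-Reasoning
  B[Nd∸1]≤dA : B * (N * d ∸ 1) ≤ d * A
  B[Nd∸1]≤dA with n , [Nd∸1]n!≤d·eₙ ← N≤eᵏ d (s≤s z≤n) =
    *-cancelʳ-≤ _ _ (n !) {{n !≢0}} $ begin
      B * (N * d ∸ 1) * n !    ≡⟨ *-assoc B _ (n !) ⟩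
      B * ((N * d ∸ 1) * n !)  ≤⟨ *-monoʳ-≤ B [Nd∸1]n!≤d·eₙ ⟩
      B * (d * expPS k n)      ≡⟨ *-CS.x∙yz≈y∙xz B d _ ⟩
      d * (B * expPS k n)      ≤⟨ *-monoʳ-≤ d (Beᵏ≤A n) ⟩
      d * (A * n !)            ≡⟨ *-assoc d A (n !) ⟨
      d * A * n !              ∎
  NBd<[1+A]d : N * B * d < suc A * d
  NBd<[1+A]d = begin-strict
    N * B * d                ≡⟨ *-CS.xy∙z≈y∙xz N B d ⟩
    B * (N * d)              ≤⟨ *-monoʳ-≤ B (m≤n+m∸n (N * d) 1) ⟩
    B * suc (N * d ∸ 1)      ≡⟨ *-suc B _ ⟩
    B + B * (N * d ∸ 1)      ≤⟨ +-monoʳ-≤ B B[Nd∸1]≤dA ⟩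
    B + d * A                <⟨ +-monoˡ-< (d * A) (n<1+n B) ⟩
    d + d * A                ≡⟨ *-suc d A ⟨
    d * suc A                ≡⟨ *-comm d (suc A) ⟩
    suc A * d                ∎

rising : ℕ → ℕ → ℕ
rising m zero    = 1
rising m (suc j) = rising m j * (m + j)

rising-suc : ∀ m j → rising m (suc j) ≡ m * rising (suc m) j
rising-suc m zero    = trans (+-identityʳ (m + 0)) (trans (+-identityʳ m) (sym (*-identityʳ m)))
rising-suc m (suc j) = begin
  rising m (suc j) * (m + suc j)        ≡⟨ cong₂ _*_ (rising-suc m j) (+-suc m j) ⟩
  m * rising (suc m) j * suc (m + j)    ≡⟨ *-assoc m _ _ ⟩
  m * (rising (suc m) j * (suc m + j))  ∎
  where open ≡-Reasoning

rising-pascal : ∀ m j → rising (suc m) (suc j) ≡ rising m (suc j) + suc j * rising (suc m) j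
rising-pascal m j = begin
  r * (suc m + j)     ≡⟨ cong (r *_) (+-suc m j) ⟨
  r * (m + suc j)     ≡⟨ *-distribˡ-+ r m (suc j) ⟩
  r * m + r * suc j   ≡⟨ cong₂ _+_ (*-comm r m) (*-comm r (suc j)) ⟩
  m * r + suc j * r   ≡⟨ cong (_+ suc j * r) (rising-suc m j) ⟨
  rising m (suc j) + suc j * r ∎
  where
  open ≡-Reasoning
  r : ℕ
  r = rising (suc m) j

^≤rising : ∀ m j → m ^ j ≤ rising m j
^≤rising m zero    = ≤-refl
^≤rising m (suc j) = begin
  m * m ^ j         ≡⟨ *-comm m (m ^ j) ⟩
  m ^ j * m         ≤⟨ *-mono-≤ (^≤rising m j) (m≤m+n m j) ⟩
  rising m j * (m + j) ∎
  where open ≤-Reasoning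

-- series m n is n! Nⁿ times the n-th partial sum of (1 - x)⁻ᵐ = ∑ⱼ rising m j xʲ / j!, x = k / N.
module Series (N k : ℕ) where

  series : ℕ → ℕ → ℕ
  series m zero    = 1
  series m (suc n) = suc n * N * series m n + rising m (suc n) * k ^ suc n

  series-zero : ∀ n → series 0 n ≡ n ! * N ^ n
  series-zero zero    = refl
  series-zero (suc n) = begin
    suc n * N * series 0 n + rising 0 (suc n) * k ^ suc n
      ≡⟨ cong₂ (λ s r → suc n * N * s + r * k ^ suc n) (series-zero n) (rising-suc 0 n) ⟩
    suc n * N * (n ! * N ^ n) + 0                         ≡⟨ +-identityʳ _ ⟩
    suc n * N * (n ! * N ^ n)                             ≡⟨ *-CS.interchange (suc n) N (n !) (N ^ n) ⟩
    suc n * n ! * (N * N ^ n)                             ∎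
    where open ≡-Reasoning

  series-pascal : ∀ m n → series (suc m) (suc n) ≡ series m (suc n) + suc n * k * series (suc m) n
  series-pascal m zero    = begin
    1 * N * 1 + rising (suc m) 1 * (k * 1)                ≡⟨ cong (λ r → 1 * N * 1 + r * (k * 1)) (rising-pascal m 0) ⟩
    1 * N * 1 + (rising m 1 + 1 * 1) * (k * 1)            ≡⟨ regroup N (rising m 1) k ⟩
    1 * N * 1 + rising m 1 * (k * 1) + 1 * k * 1          ∎
    where
    open ≡-Reasoning
    regroup : ∀ N r k → 1 * N * 1 + (r + 1 * 1) * (k * 1) ≡ 1 * N * 1 + r * (k * 1) + 1 * k * 1
    regroup = solve-∀
  series-pascal m (suc n) = begin
    a * N * series (suc m) (suc n) + rising (suc m) a * k ^ a
      ≡⟨ cong₂ (λ s r → a * N * s + r * k ^ a) (series-pascal m n) (rising-pascal m (suc n)) ⟩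
    a * N * (series m (suc n) + suc n * k * series (suc m) n) + (rising m a + a * rising (suc m) (suc n)) * k ^ a
      ≡⟨ regroup n N k (series m (suc n)) (series (suc m) n) (rising m a) (rising (suc m) (suc n)) (k ^ suc n) ⟩
    (a * N * series m (suc n) + rising m a * k ^ a) + a * k * (suc n * N * series (suc m) n + rising (suc m) (suc n) * k ^ suc n)
      ∎
    where
    open ≡-Reasoning
    a : ℕ
    a = suc (suc n)
    regroup : ∀ n N k s t r ρ p →
      suc (suc n) * N * (s + suc n * k * t) + (r + suc (suc n) * ρ) * (k * p) ≡
      (suc (suc n) * N * s + r * (k * p)) + suc (suc n) * k * (suc n * N * t + ρ * p)
    regroup = solve-∀

  expPS*^≤series : ∀ n → expPS k n * N ^ n ≤ series N n
  expPS*^≤series zero    = ≤-refl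
  expPS*^≤series (suc n) = begin
    (suc n * expPS k n + k ^ suc n) * (N * N ^ n)
      ≡⟨ regroup (suc n) (expPS k n) (k ^ suc n) N (N ^ n) ⟩
    suc n * N * (expPS k n * N ^ n) + N * N ^ n * k ^ suc n
      ≤⟨ +-mono-≤ (*-monoʳ-≤ (suc n * N) (expPS*^≤series n)) (*-monoˡ-≤ (k ^ suc n) (^≤rising N (suc n))) ⟩
    suc n * N * series N n + rising N (suc n) * k ^ suc n ∎
    where
    open ≤-Reasoning
    regroup : ∀ a e p N r → (a * e + p) * (N * r) ≡ a * N * (e * r) + N * r * p
    regroup = solve-∀

module _ (K k : ℕ) where

  open Series (K + k) k

  private
    N : ℕ
    N = K + k

  -- (1 - x) · (1 - x)⁻⁽ᵐ⁺¹⁾ ≤ (1 - x)⁻ᵐ at the level of partial sums, with 1 - x = K / N.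
  *-series-suc≤ : ∀ m n → K * series (suc m) n ≤ (K + k) * series m n
  *-series-suc≤ m zero    = *-monoˡ-≤ 1 (m≤m+n K k)
  *-series-suc≤ m (suc n) = +-cancelʳ-≤ (k * t) _ _ $ begin
    K * t + k * t                              ≡⟨ *-distribʳ-+ t K k ⟨
    N * t                                      ≡⟨ cong (N *_) (series-pascal m n) ⟩
    N * (s + suc n * k * u)                    ≡⟨ regroup N s (suc n) k u ⟩
    N * s + k * (suc n * N * u)                ≤⟨ +-monoʳ-≤ (N * s) (*-monoʳ-≤ k (m≤m+n _ _)) ⟩
    N * s + k * t                              ∎
    where
    open ≤-Reasoning
    s t u : ℕ
    s = series m (suc n)
    t = series (suc m) (suc n)
    u = series (suc m) n
    regroup : ∀ N s a k u → N * (s + a * k * u) ≡ N * s + k * (a * N * u)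
    regroup = solve-∀

  ^*series≤ : ∀ m n → K ^ m * series m n ≤ (K + k) ^ m * (n ! * (K + k) ^ n)
  ^*series≤ zero    n = ≤-reflexive (cong (1 *_) (series-zero n))
  ^*series≤ (suc m) n = begin
    K * K ^ m * series (suc m) n     ≡⟨ *-CS.xy∙z≈y∙xz K (K ^ m) _ ⟩
    K ^ m * (K * series (suc m) n)   ≤⟨ *-monoʳ-≤ (K ^ m) (*-series-suc≤ m n) ⟩
    K ^ m * (N * series m n)         ≡⟨ *-CS.x∙yz≈y∙xz (K ^ m) N _ ⟩
    N * (K ^ m * series m n)         ≤⟨ *-monoʳ-≤ N (^*series≤ m n) ⟩
    N * (N ^ m * (n ! * N ^ n))      ≡⟨ *-assoc N (N ^ m) _ ⟨
    N * N ^ m * (n ! * N ^ n)        ∎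
    where open ≤-Reasoning

  -- e^k ≤ (1 - x)⁻ᴺ, since Nʲ ≤ rising N j termwise.
  ^·e^≤^ : .{{_ : NonZero K}} → K ^ (K + k) ·e^ k ≤ (K + k) ^ (K + k)
  ^·e^≤^ n = *-cancelʳ-≤ _ _ (N ^ n) {{m^n≢0 N n {{N≢0}}}} $ begin
    K ^ N * expPS k n * N ^ n    ≡⟨ *-assoc (K ^ N) _ _ ⟩
    K ^ N * (expPS k n * N ^ n)  ≤⟨ *-monoʳ-≤ (K ^ N) (expPS*^≤series n) ⟩
    K ^ N * series N n           ≤⟨ ^*series≤ N n ⟩
    N ^ N * (n ! * N ^ n)        ≡⟨ *-assoc (N ^ N) _ _ ⟨
    N ^ N * n ! * N ^ n          ∎
    where
    open ≤-Reasoning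
    N≢0 : NonZero N
    N≢0 = >-nonZero (≤-trans (>-nonZero⁻¹ K) (m≤m+n K k))

module Parameters (β γ : ℕ) where

  b q q′ : ℕ
  b  = 2 + β
  q  = 3 + γ
  q′ = 2 + γ

  -- K / D = ((q - 2) + 1 / (b - 1)) / (q - 1): if at most a 1/(b - 1) fraction of the colourings
  -- of a subtree with a given root colour is unforced, then at most a K / D fraction of the
  -- colourings allowed below a c-coloured parent is c′-permitting.
  K D : ℕ
  K = (1 + γ) * (1 + β) + 1
  D = K + β

  D≡[b-1]q′ : D ≡ (1 + β) * q′
  D≡[b-1]q′ = expand β γ
    where
    expand : ∀ β γ → (1 + γ) * (1 + β) + 1 + β ≡ (1 + β) * (2 + γ)
    expand = solve-∀

  ·e^-from-ratio : ∀ x y → x * D ^ (1 + β) ≤ q′ * K ^ (1 + β) * y →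
                   x ^ q′ ·e^ β ≤ (q′ * y) ^ q′
  ·e^-from-ratio x y xDᵇ⁻¹≤q′Kᵇ⁻¹y n = *-cancelʳ-≤ _ _ (D ^ D) {{m^n≢0 D D}} $ begin
    x ^ q′ * expPS β n * D ^ D               ≡⟨ *-CS.xy∙z≈xz∙y (x ^ q′) _ _ ⟩
    x ^ q′ * D ^ D * expPS β n               ≡⟨ cong (_* expPS β n) lhs-power ⟩
    (x * D ^ (1 + β)) ^ q′ * expPS β n       ≤⟨ *-monoˡ-≤ (expPS β n) (^-monoˡ-≤ q′ xDᵇ⁻¹≤q′Kᵇ⁻¹y) ⟩
    (q′ * K ^ (1 + β) * y) ^ q′ * expPS β n  ≡⟨ cong (_* expPS β n) rhs-power ⟩
    (q′ * y) ^ q′ * K ^ D * expPS β n        ≡⟨ *-assoc ((q′ * y) ^ q′) _ _ ⟩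
    (q′ * y) ^ q′ * (K ^ D * expPS β n)      ≤⟨ *-monoʳ-≤ ((q′ * y) ^ q′) (^·e^≤^ K β n) ⟩
    (q′ * y) ^ q′ * (D ^ D * n !)            ≡⟨ *-CS.x∙yz≈xz∙y ((q′ * y) ^ q′) _ _ ⟩
    (q′ * y) ^ q′ * n ! * D ^ D              ∎
    where
    open ≤-Reasoning
    ^[b-1]q′ : ∀ z → (z ^ (1 + β)) ^ q′ ≡ z ^ D
    ^[b-1]q′ z = trans (^-*-assoc z (1 + β) q′) (cong (z ^_) (sym D≡[b-1]q′))
    lhs-power : x ^ q′ * D ^ D ≡ (x * D ^ (1 + β)) ^ q′
    lhs-power = trans (cong (x ^ q′ *_) (sym (^[b-1]q′ D))) (sym (^-distrib-* x _ q′))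
    rhs-power : (q′ * K ^ (1 + β) * y) ^ q′ ≡ (q′ * y) ^ q′ * K ^ D
    rhs-power = begin-equality
      (q′ * K ^ (1 + β) * y) ^ q′     ≡⟨ cong (_^ q′) (*-CS.xy∙z≈xz∙y q′ _ y) ⟩
      (q′ * y * K ^ (1 + β)) ^ q′     ≡⟨ ^-distrib-* (q′ * y) _ q′ ⟩
      (q′ * y) ^ q′ * (K ^ (1 + β)) ^ q′ ≡⟨ cong ((q′ * y) ^ q′ *_) (^[b-1]q′ K) ⟩
      (q′ * y) ^ q′ * K ^ D           ∎

  module _ (b^2q≤eᵇ : b ^ (2 * q) ≤e^ b) where

    b^2q≤4^b : b ^ (2 * q) ≤ 4 ^ b
    b^2q≤4^b = *-cancelʳ-≤ _ _ (b ^ (b + b)) {{m^n≢0 b (b + b)}} $ begin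
      b ^ (2 * q) * b ^ (b + b) ≤⟨ ≤e^-·e^≤⇒*≤ (b ^ (2 * q)) b (b ^ (b + b)) ((b + b) ^ (b + b)) b^2q≤eᵇ (^·e^≤^ b b) ⟩
      (b + b) ^ (b + b)         ≡⟨ cong (λ m → (b + m) ^ (b + b)) (+-identityʳ b) ⟨
      (2 * b) ^ (b + b)         ≡⟨ ^-distrib-* 2 b (b + b) ⟩
      2 ^ (b + b) * b ^ (b + b) ≡⟨ cong (_* b ^ (b + b)) 2^[b+b]≡4^b ⟩
      4 ^ b * b ^ (b + b)       ∎
      where
      open ≤-Reasoning
      2^[b+b]≡4^b : 2 ^ (b + b) ≡ 4 ^ b
      2^[b+b]≡4^b = trans (^-distribˡ-+-* 2 b b) (sym (^-distrib-* 2 2 b))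

    4≤b : 4 ≤ b
    4≤b = b^6≤4^b⇒4≤b β (≤-trans (^-monoʳ-≤ b (*-monoʳ-≤ 2 {3} {q} (s≤s (s≤s (s≤s z≤n))))) b^2q≤4^b)
      where
      b^6≤4^b⇒4≤b : ∀ β → (2 + β) ^ 6 ≤ 4 ^ (2 + β) → 4 ≤ 2 + β
      b^6≤4^b⇒4≤b 0               b^6≤4^b = contradiction b^6≤4^b (from-no (2 ^ 6 ≤? 4 ^ 2))
      b^6≤4^b⇒4≤b 1               b^6≤4^b = contradiction b^6≤4^b (from-no (3 ^ 6 ≤? 4 ^ 3))
      b^6≤4^b⇒4≤b (suc (suc β))   _       = s≤s (s≤s (s≤s (s≤s z≤n)))

    2q′≤b : 2 * q′ ≤ b
    2q′≤b = ≮⇒≥ λ b<2q′ → <⇒≱ (4^b<b^2q b<2q′) b^2q≤4^b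
      where
      open ≤-Reasoning
      4^b<b^2q : b < 2 * q′ → 4 ^ b < b ^ (2 * q)
      4^b<b^2q b<2q′ = begin-strict
        4 ^ b       <⟨ m<m*n (4 ^ b) b {{m^n≢0 4 b}} (s≤s (s≤s z≤n)) ⟩
        4 ^ b * b   ≤⟨ *-monoˡ-≤ b (^-monoˡ-≤ b 4≤b) ⟩
        b ^ b * b   ≡⟨ *-comm (b ^ b) b ⟩
        b ^ suc b   ≤⟨ ^-monoʳ-≤ b (≤-trans b<2q′ (*-monoʳ-≤ 2 (n≤1+n q′))) ⟩
        b ^ (2 * q) ∎

    -- D′ = (b + 2)(q - 1) and K′ = D′ - b are chosen so that K / D ≤ K′ / D′ and D′ ≤ q b.
    K′ D′ : ℕ
    K′ = (4 + β) * (1 + γ) + 2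
    D′ = K′ + b

    private instance
      D′≢0 : NonZero D′
      D′≢0 = >-nonZero (≤-trans (s≤s z≤n) (m≤n+m b K′))

    K*D′≤D*K′ : K * D′ ≤ D * K′
    K*D′≤D*K′ = +-cancelʳ-≤ (q′ * 2) _ _ $ begin
      K * D′ + q′ * 2  ≤⟨ +-monoʳ-≤ (K * D′) (*-monoʳ-≤ q′ (s≤s⁻¹ (s≤s⁻¹ 4≤b))) ⟩
      K * D′ + q′ * β  ≡⟨ expand β γ ⟩
      D * K′ + q′ * 2  ∎
      where
      open ≤-Reasoning
      expand : ∀ β γ → ((1 + γ) * (1 + β) + 1) * ((4 + β) * (1 + γ) + 2 + (2 + β)) + (2 + γ) * β ≡
                       ((1 + γ) * (1 + β) + 1 + β) * ((4 + β) * (1 + γ) + 2) + (2 + γ) * 2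
      expand = solve-∀

    D′≤qb : D′ ≤ q * b
    D′≤qb = begin
      D′               ≡⟨ expand β γ ⟩
      2 * q′ + b * q′  ≤⟨ +-monoˡ-≤ (b * q′) 2q′≤b ⟩
      b + b * q′       ≡⟨ *-suc b q′ ⟨
      b * q            ≡⟨ *-comm b q ⟩
      q * b            ∎
      where
      open ≤-Reasoning
      expand : ∀ β γ → (4 + β) * (1 + γ) + 2 + (2 + β) ≡ 2 * (2 + γ) + (2 + β) * (2 + γ)
      expand = solve-∀

    D^D′≤b^2qb : D ^ D′ ≤ (b ^ (2 * q)) ^ b
    D^D′≤b^2qb = begin
      D ^ D′                   ≤⟨ ^-monoˡ-≤ D′ D≤b*b ⟩
      (b * b) ^ D′             ≤⟨ ^-monoʳ-≤ (b * b) D′≤qb ⟩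
      (b * b) ^ (q * b)        ≡⟨ ^-distrib-* b b (q * b) ⟩
      b ^ (q * b) * b ^ (q * b) ≡⟨ ^-distribˡ-+-* b (q * b) (q * b) ⟨
      b ^ (q * b + q * b)      ≡⟨ cong (b ^_) (cong (q * b +_) (+-identityʳ (q * b))) ⟨
      b ^ (2 * (q * b))        ≡⟨ cong (b ^_) (*-assoc 2 q b) ⟨
      b ^ (2 * q * b)          ≡⟨ ^-*-assoc b (2 * q) b ⟨
      (b ^ (2 * q)) ^ b        ∎
      where
      open ≤-Reasoning
      D≤b*b : D ≤ b * b
      D≤b*b = ≤-trans (≤-reflexive D≡[b-1]q′) (*-mono-≤ (n≤1+n (1 + β)) (≤-trans (m≤m+n q′ (q′ + 0)) 2q′≤b))

    b^2q*K^D′≤D^D′ : b ^ (2 * q) * K ^ D′ ≤ D ^ D′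
    b^2q*K^D′≤D^D′ = *-cancelʳ-≤ _ _ (D′ ^ D′) {{m^n≢0 D′ D′}} $ begin
      b ^ (2 * q) * K ^ D′ * D′ ^ D′     ≡⟨ *-assoc (b ^ (2 * q)) _ _ ⟩
      b ^ (2 * q) * (K ^ D′ * D′ ^ D′)   ≡⟨ cong (b ^ (2 * q) *_) (^-distrib-* K D′ D′) ⟨
      b ^ (2 * q) * (K * D′) ^ D′        ≤⟨ *-monoʳ-≤ (b ^ (2 * q)) (^-monoˡ-≤ D′ K*D′≤D*K′) ⟩
      b ^ (2 * q) * (D * K′) ^ D′        ≡⟨ cong (b ^ (2 * q) *_) (^-distrib-* D K′ D′) ⟩
      b ^ (2 * q) * (D ^ D′ * K′ ^ D′)   ≡⟨ *-CS.x∙yz≈xz∙y (b ^ (2 * q)) _ _ ⟩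
      b ^ (2 * q) * K′ ^ D′ * D ^ D′
        ≤⟨ *-monoˡ-≤ (D ^ D′) (≤e^-·e^≤⇒*≤ (b ^ (2 * q)) b (K′ ^ D′) (D′ ^ D′) b^2q≤eᵇ (^·e^≤^ K′ b)) ⟩
      D′ ^ D′ * D ^ D′                   ≡⟨ *-comm (D′ ^ D′) _ ⟩
      D ^ D′ * D′ ^ D′                   ∎
      where open ≤-Reasoning

    -- With K′ / D′ ≥ K / D, the hypothesis and ^·e^≤^ K′ b give b²ᵍ ≤ (D′ / K′)ᴰ′ ≤ (D / K)ᴰ′;
    -- raising to the b-th power and using Dᴰ′ ≤ b²ᵍᵇ yields (D Kᵇ)ᴰ′ ≤ (Dᵇ)ᴰ′.
    D*K^b≤D^b : D * K ^ b ≤ D ^ b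
    D*K^b≤D^b = ^-cancelʳ-≤ _ _ D′ $ begin
      (D * K ^ b) ^ D′                  ≡⟨ ^-distrib-* D (K ^ b) D′ ⟩
      D ^ D′ * (K ^ b) ^ D′             ≤⟨ *-monoˡ-≤ _ D^D′≤b^2qb ⟩
      (b ^ (2 * q)) ^ b * (K ^ b) ^ D′  ≡⟨ cong ((b ^ (2 * q)) ^ b *_) (^-comm K b D′) ⟩
      (b ^ (2 * q)) ^ b * (K ^ D′) ^ b  ≡⟨ ^-distrib-* (b ^ (2 * q)) (K ^ D′) b ⟨
      (b ^ (2 * q) * K ^ D′) ^ b        ≤⟨ ^-monoˡ-≤ b b^2q*K^D′≤D^D′ ⟩
      (D ^ D′) ^ b                      ≡⟨ ^-comm D D′ b ⟩
      (D ^ b) ^ D′                      ∎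
      where open ≤-Reasoning

module Enumeration (m n : ℕ) where

  b q′ q : ℕ
  b  = suc m
  q′ = suc n
  q  = suc q′

  Colouring : ℕ → Set
  Colouring = Col b q

  rootOf : ∀ h → Colouring h → Fin q
  rootOf = root

  IsProper IsForced : ∀ h → Colouring h → Set
  IsProper = Proper
  IsForced = Forced

  leavesOf : ∀ h → Colouring h → List (Fin q)
  leavesOf = leaves

  ≟-colouring : ∀ h → DecidableEquality (Colouring h)
  ≟-colouring zero    = Finₚ._≟_
  ≟-colouring (suc h) = ×ₚ.≡-dec Finₚ._≟_ (Vecₚ.≡-dec (≟-colouring h))

  nodes : ∀ {h} → Fin q → (Fin b → List (Colouring h)) → List (Colouring (suc h))
  nodes c xss = map (c ,_) (cartesian xss)

  ∈-nodes⁺ : ∀ {h} c (xss : Fin b → List (Colouring h)) {ts} →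
             (∀ i → lookup ts i ∈ xss i) → (c , ts) ∈ nodes c xss
  ∈-nodes⁺ c xss ts∈ = ∈-map⁺ (c ,_) (∈-cartesian⁺ xss ts∈)

  ∈-nodes⁻ : ∀ {h} c (xss : Fin b → List (Colouring h)) {c′ ts} →
             (c′ , ts) ∈ nodes c xss → c′ ≡ c × (∀ i → lookup ts i ∈ xss i)
  ∈-nodes⁻ c xss t∈ with _ , ts∈ , refl ← ∈-map⁻ (c ,_) t∈ = refl , ∈-cartesian⁻ xss ts∈

  unique-nodes : ∀ {h} c (xss : Fin b → List (Colouring h)) → (∀ i → Unique (xss i)) → Unique (nodes c xss)
  unique-nodes c xss uniq = map⁺ ×ₚ.,-injectiveʳ (unique-cartesian xss uniq)

  length-nodes : ∀ {h} c (xss : Fin b → List (Colouring h)) → length (nodes c xss) ≡ ∏ (length ∘ xss)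
  length-nodes c xss = trans (length-map (c ,_) (cartesian xss)) (length-cartesian xss)

  mutual
    colourings : ∀ h → Fin q → List (Colouring h)
    colourings zero    c = [ c ]
    colourings (suc h) c = nodes c (const (colouringsAvoiding h c))

    colouringsAvoiding : ∀ h → Fin q → List (Colouring h)
    colouringsAvoiding h c = concatFin (λ j → colourings h (punchIn c j))

  mutual
    ∈-colourings : ∀ h {t} → IsProper h t → t ∈ colourings h (rootOf h t)
    ∈-colourings zero    _ = here refl
    ∈-colourings (suc h) {c , ts} proper = ∈-nodes⁺ c _ λ i →
      ∈-colouringsAvoiding h (proj₂ (lookup⁺ proper i)) (proj₁ (lookup⁺ proper i))

    ∈-colouringsAvoiding : ∀ h {c t} → IsProper h t → rootOf h t ≢ c → t ∈ colouringsAvoiding h c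
    ∈-colouringsAvoiding h {c} {t} proper t≢c =
      ∈-concatFin⁺ (λ j → colourings h (punchIn c j)) (punchOut c≢t)
        (subst (λ c′ → t ∈ colourings h c′) (sym (punchIn-punchOut c≢t)) (∈-colourings h proper))
      where
      c≢t : c ≢ rootOf h t
      c≢t = t≢c ∘ sym

  mutual
    colourings-sound : ∀ h {c t} → t ∈ colourings h c → IsProper h t × rootOf h t ≡ c
    colourings-sound zero    (here refl) = tt , refl
    colourings-sound (suc h) {c} {c′ , ts} t∈ with refl , ts∈ ← ∈-nodes⁻ c (const (colouringsAvoiding h c)) t∈ =
      lookup⁻ (λ i → swap (colouringsAvoiding-sound h (ts∈ i))) , refl

    colouringsAvoiding-sound : ∀ h {c t} → t ∈ colouringsAvoiding h c → IsProper h t × rootOf h t ≢ c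
    colouringsAvoiding-sound h {c} t∈ with j , t∈ⱼ ← ∈-concatFin⁻ _ t∈ with proper , t≡ ← colourings-sound h t∈ⱼ =
      proper , λ t≡c → punchInᵢ≢i c j (trans (sym t≡) t≡c)

  mutual
    unique-colourings : ∀ h c → Unique (colourings h c)
    unique-colourings zero    c = All.[] ∷ []
    unique-colourings (suc h) c = unique-nodes c _ (λ _ → unique-colouringsAvoiding h c)

    unique-colouringsAvoiding : ∀ h c → Unique (colouringsAvoiding h c)
    unique-colouringsAvoiding h c = unique-concatFin _ (λ j → unique-colourings h (punchIn c j))
      λ i j t∈ᵢ t∈ⱼ → punchIn-injective c i j (trans (sym (proj₂ (colourings-sound h t∈ᵢ))) (proj₂ (colourings-sound h t∈ⱼ)))

  #colourings : ℕ → ℕ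
  #colourings zero    = 1
  #colourings (suc h) = (q′ * #colourings h) ^ b

  mutual
    length-colourings : ∀ h c → length (colourings h c) ≡ #colourings h
    length-colourings zero    c = refl
    length-colourings (suc h) c =
      trans (length-nodes c (const (colouringsAvoiding h c)))
        (trans (∏-cong {b} (λ _ → length-colouringsAvoiding h c)) (∏-const b (q′ * #colourings h)))

    length-colouringsAvoiding : ∀ h c → length (colouringsAvoiding h c) ≡ q′ * #colourings h
    length-colouringsAvoiding h c =
      trans (length-concatFin (λ j → colourings h (punchIn c j)))
        (trans (∑-cong {q′} (λ j → length-colourings h (punchIn c j))) (∑-const q′ (#colourings h)))

  -- Colourings whose root is not forced

  -- unforced h c contains every proper colouring with root colour c whose root is not forced,
  -- and permitting h c i every proper colouring of a child of a c-coloured vertex that is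
  -- (punchIn c i)-permitting.
  unforced : ∀ h → Fin q → List (Colouring h)
  permitting : ∀ h → Fin q → Fin q′ → List (Colouring h)

  unforced zero    c = []
  unforced (suc h) c = concatFin λ i → nodes c (const (permitting h c i))

  permitting h c i =
    concatFin (updateAt (λ j → colourings h (punchIn c j)) i (const (unforced h (punchIn c i))))

  #unforced #permitting : ℕ → ℕ
  #unforced zero    = 0
  #unforced (suc h) = q′ * #permitting h ^ b
  #permitting h = #unforced h + n * #colourings h

  length-unforced : ∀ h c → length (unforced h c) ≤ #unforced h
  length-permitting : ∀ h c i → length (permitting h c i) ≤ #permitting h

  length-unforced zero    c = z≤n
  length-unforced (suc h) c = begin
    length (unforced (suc h) c)            ≡⟨ length-concatFin (λ i → nodes c (const (permitting h c i))) ⟩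
    ∑ (λ i → length (nodes c (const (permitting h c i))))
      ≤⟨ ∑-mono-≤ {q′} (λ i → ≤-trans (≤-reflexive (length-nodes c (const (permitting h c i))))
                                      (∏-mono-≤ {b} (λ _ → length-permitting h c i))) ⟩
    ∑ {q′} (const (∏ {b} (const (#permitting h)))) ≡⟨ ∑-const q′ _ ⟩
    q′ * ∏ {b} (const (#permitting h))             ≡⟨ cong (q′ *_) (∏-const b (#permitting h)) ⟩
    q′ * #permitting h ^ b                          ∎
    where open ≤-Reasoning

  length-permitting h c i = ≤-trans (≤-reflexive (length-concatFin entries))
    (∑-≤-except (length ∘ entries) i
      (≤-trans (≤-reflexive (cong length (updateAt-updates i (λ j → colourings h (punchIn c j))))) (length-unforced h _))
      λ j j≢i → ≤-reflexive (trans (cong length (updateAt-minimal j i _ j≢i)) (length-colourings h _)))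
    where
    entries : Fin q′ → List (Colouring h)
    entries = updateAt (λ j → colourings h (punchIn c j)) i (const (unforced h (punchIn c i)))

  ∈-permitting : ∀ h {c i t} → IsProper h t → rootOf h t ≢ c →
                 rootOf h t ≢ punchIn c i ⊎ t ∈ unforced h (rootOf h t) → t ∈ permitting h c i
  ∈-permitting h {c} {i} {t} proper t≢c permits =
    ∈-concatFin⁺ entries j (updateAt-elim (t ∈_) (λ j → colourings h (punchIn c j)) i j
      (λ { refl → at-i permits })
      (λ _ → subst (λ c′ → t ∈ colourings h c′) (sym cⱼ≡t) (∈-colourings h proper)))
    where
    entries : Fin q′ → List (Colouring h)
    entries = updateAt (λ j → colourings h (punchIn c j)) i (const (unforced h (punchIn c i)))
    j : Fin q′
    j = punchOut (t≢c ∘ sym)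
    cⱼ≡t : punchIn c j ≡ rootOf h t
    cⱼ≡t = punchIn-punchOut (t≢c ∘ sym)
    at-i : rootOf h t ≢ punchIn c j ⊎ t ∈ unforced h (rootOf h t) → t ∈ unforced h (punchIn c j)
    at-i (inj₁ t≢cⱼ) = contradiction (sym cⱼ≡t) t≢cⱼ
    at-i (inj₂ t∈)   = subst (λ c′ → t ∈ unforced h c′) (sym cⱼ≡t) t∈

  ∉permitting⇒ : ∀ h {c i t} → IsProper h t → rootOf h t ≢ c → t ∉ permitting h c i →
                 rootOf h t ≡ punchIn c i × t ∉ unforced h (rootOf h t)
  ∉permitting⇒ h {c} {i} {t} proper t≢c t∉ with rootOf h t Finₚ.≟ punchIn c i
  ... | yes t≡cᵢ = t≡cᵢ , λ t∈ → t∉ (∈-permitting h {c} {i} proper t≢c (inj₂ t∈))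
  ... | no  t≢cᵢ = contradiction (∈-permitting h proper t≢c (inj₁ t≢cᵢ)) t∉

  length-leaves : ∀ h (t : Colouring h) → length (leavesOf h t) ≡ b ^ h
  length-leaves zero    t        = refl
  length-leaves (suc h) (c , ts) = go ts
    where
    go : ∀ {k} (vs : Vec (Colouring h) k) → length (concatMap (leavesOf h) (toList vs)) ≡ k * b ^ h
    go []       = refl
    go (v ∷ vs) = trans (length-++ (leavesOf h v)) (cong₂ _+_ (length-leaves h v) (go vs))

  leaves-child : ∀ h {c c′} {ts ys : Vec (Colouring h) b} →
                 leavesOf (suc h) (c , ts) ≡ leavesOf (suc h) (c′ , ys) → ∀ i → leavesOf h (lookup ts i) ≡ leavesOf h (lookup ys i)
  leaves-child h {ts = ts} {ys} = go ts ys
    where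
    go : ∀ {k} (ts ys : Vec (Colouring h) k) → concatMap (leavesOf h) (toList ts) ≡ concatMap (leavesOf h) (toList ys) →
         ∀ i → leavesOf h (lookup ts i) ≡ leavesOf h (lookup ys i)
    go (t ∷ ts) (y ∷ ys) eq i
      with t≡y , ts≡ys ← ++-injective (leavesOf h t) (leavesOf h y) (trans (length-leaves h t) (sym (length-leaves h y))) eq
      with i
    ... | zero  = t≡y
    ... | suc i = go ts ys ts≡ys i

  -- A proper y with the leaves of t and root colour c′ ≠ c is impossible: as t ∉ unforced, some
  -- child of t is not c′-permitting, i.e. it is forced and coloured c′, and then so is the
  -- corresponding child of y.
  ∉unforced⇒forced : ∀ h {t} → IsProper h t → t ∉ unforced h (rootOf h t) → IsForced h t
  ∉unforced⇒forced zero    _ _ _ _ same-leaves = ∷-injectiveˡ same-leaves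
  ∉unforced⇒forced (suc h) {c , ts} proper t∉ (c′ , ys) proper-y same-leaves with c′ Finₚ.≟ c
  ... | yes c′≡c = c′≡c
  ... | no  c′≢c = contradiction y-child-root (proj₁ (lookup⁺ proper-y k))
    where
    c≢c′ : c ≢ c′
    c≢c′ = c′≢c ∘ sym
    i : Fin q′
    i = punchOut c≢c′
    blocking-child : ∃[ k ] lookup ts k ∉ permitting h c i
    blocking-child = Finₚ.¬∀⟶∃¬ b _ (λ k → DecMembership._∈?_ (≟-colouring h) (lookup ts k) (permitting h c i))
      λ ts∈ → t∉ (∈-concatFin⁺ (λ i → nodes c (const (permitting h c i))) i (∈-nodes⁺ c _ ts∈))
    k : Fin b
    k = proj₁ blocking-child
    tₖ-root : rootOf h (lookup ts k) ≡ punchIn c i × lookup ts k ∉ unforced h (rootOf h (lookup ts k))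
    tₖ-root = ∉permitting⇒ h (proj₂ (lookup⁺ proper k)) (proj₁ (lookup⁺ proper k)) (proj₂ blocking-child)
    y-child-root : rootOf h (lookup ys k) ≡ c′
    y-child-root = begin
      rootOf h (lookup ys k) ≡⟨ ∉unforced⇒forced h (proj₂ (lookup⁺ proper k)) (proj₂ tₖ-root)
                                   (lookup ys k) (proj₂ (lookup⁺ proper-y k)) (leaves-child h {c′} {c} {ys} {ts} same-leaves k) ⟩
      rootOf h (lookup ts k) ≡⟨ proj₁ tₖ-root ⟩
      punchIn c i            ≡⟨ punchIn-punchOut c≢c′ ⟩
      c′                     ∎
      where open ≡-Reasoning

  ∈-unforced : ∀ h {t} → IsProper h t → ¬ IsForced h t → t ∈ unforced h (rootOf h t)
  ∈-unforced h {t} proper unforced-t with DecMembership._∈?_ (≟-colouring h) t (unforced h (rootOf h t))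
  ... | yes t∈ = t∈
  ... | no  t∉ = contradiction (∉unforced⇒forced h proper t∉) unforced-t

  -- Loose colourings

  -- loose h c j contains every proper colouring of height h + 1 with root colour c that is
  -- loose for a leaf below child j.
  loose : ∀ h → Fin q → Fin b → List (Colouring (suc h))
  loose h c j = concatFin λ i → nodes c (updateAt (const (permitting h c i)) j (const (colouringsAvoiding h c)))

  ∈-loose : ∀ h {s} (ℓ : Vec (Fin b) (suc h)) → IsProper (suc h) s → Loose h s ℓ →
            s ∈ loose h (rootOf (suc h) s) (head ℓ)
  ∈-loose h {c , ts} ℓ proper (c′ , c′≢c , permits) =
    ∈-concatFin⁺ (λ i → nodes c (updateAt (const (permitting h c i)) (head ℓ) (const (colouringsAvoiding h c)))) i
      (∈-nodes⁺ c _ λ k → updateAt-elim (lookup ts k ∈_) (const (permitting h c i)) (head ℓ) k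
        (λ _ → ∈-colouringsAvoiding h (proj₂ (lookup⁺ proper k)) (proj₁ (lookup⁺ proper k)))
        (λ k≢j → ∈-permitting h (proj₂ (lookup⁺ proper k)) (proj₁ (lookup⁺ proper k)) (child-permits k (permits k k≢j))))
    where
    c≢c′ : c ≢ c′
    c≢c′ = c′≢c ∘ sym
    i : Fin q′
    i = punchOut c≢c′
    child-permits : ∀ k → Permitting h c′ (lookup ts k) →
                    rootOf h (lookup ts k) ≢ punchIn c i ⊎ lookup ts k ∈ unforced h (rootOf h (lookup ts k))
    child-permits k (inj₁ tₖ≢c′)     = inj₁ λ tₖ≡cᵢ → tₖ≢c′ (trans tₖ≡cᵢ (punchIn-punchOut c≢c′))
    child-permits k (inj₂ unforced-tₖ) = inj₂ (∈-unforced h (proj₂ (lookup⁺ proper k)) unforced-tₖ)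

  length-loose : ∀ h c j → length (loose h c j) ≤ q′ * (q′ * #colourings h * #permitting h ^ m)
  length-loose h c j = begin
    length (loose h c j)                 ≡⟨ length-concatFin (λ i → nodes c (entries i)) ⟩
    ∑ (λ i → length (nodes c (entries i)))
      ≤⟨ ∑-mono-≤ {q′} (λ i → ≤-trans (≤-reflexive (length-nodes c (entries i))) (each i)) ⟩
    ∑ {q′} (const (q′ * #colourings h * #permitting h ^ m)) ≡⟨ ∑-const q′ _ ⟩
    q′ * (q′ * #colourings h * #permitting h ^ m) ∎
    where
    open ≤-Reasoning
    entries : Fin q′ → Fin b → List (Colouring h)
    entries i = updateAt (const (permitting h c i)) j (const (colouringsAvoiding h c))
    each : ∀ i → ∏ (length ∘ entries i) ≤ q′ * #colourings h * #permitting h ^ m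
    each i = ∏-≤-except (length ∘ entries i) j
      (≤-reflexive (trans (cong length (updateAt-updates j (const (permitting h c i)))) (length-colouringsAvoiding h c)))
      λ k k≢j → ≤-trans (≤-reflexive (cong length (updateAt-minimal k j (const (permitting h c i)) k≢j))) (length-permitting h c i)

  -- Grafting a family of local colourings into the whole tree

  AllProperRooted : ∀ {k} → (Fin q → List (Colouring k)) → Set
  AllProperRooted {k} A = ∀ c {s} → s ∈ A c → IsProper k s × rootOf k s ≡ c

  module _ {k : ℕ} where

    -- graft d p A c: the proper colourings of height d + k with root colour c whose subtree at
    -- the vertex reached by p is coloured by an element of A.
    graft : ∀ d → Vec (Fin b) d → (Fin q → List (Colouring k)) → Fin q → List (Colouring (d + k))
    graftChildren : ∀ d → Fin b → Vec (Fin b) d → (Fin q → List (Colouring k)) → Fin q →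
                    Fin b → List (Colouring (d + k))

    graft zero    []      A c = A c
    graft (suc d) (i ∷ p) A c = nodes c (graftChildren d i p A c)

    graftChildren d i p A c =
      updateAt (const (colouringsAvoiding (d + k) c)) i (const (concatFin λ j → graft d p A (punchIn c j)))

    ∈-graft : ∀ (Q : Colouring k → Set) {A} → (∀ {s} → IsProper k s → Q s → s ∈ A (rootOf k s)) →
              ∀ d p {x} → IsProper (d + k) x → Q (subAt d p x) → x ∈ graft d p A (rootOf (d + k) x)
    ∈-graft Q complete zero    []      proper Qx = complete proper Qx
    ∈-graft Q {A} complete (suc d) (i ∷ p) {c , ts} proper Qx = ∈-nodes⁺ c (graftChildren d i p A c) λ i′ →
      updateAt-elim (lookup ts i′ ∈_) (const (colouringsAvoiding (d + k) c)) i i′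
        (λ { refl → ∈-concatFin⁺ (λ j → graft d p A (punchIn c j)) (punchOut c≢tᵢ)
              (subst (λ c′ → lookup ts i ∈ graft d p A c′) (sym (punchIn-punchOut c≢tᵢ))
                (∈-graft Q complete d p (proj₂ (lookup⁺ proper i)) Qx)) })
        (λ _ → ∈-colouringsAvoiding (d + k) (proj₂ (lookup⁺ proper i′)) (proj₁ (lookup⁺ proper i′)))
      where
      c≢tᵢ : c ≢ rootOf (d + k) (lookup ts i)
      c≢tᵢ = proj₁ (lookup⁺ proper i) ∘ sym

    graft-sound : ∀ {A} → AllProperRooted A → ∀ d p → AllProperRooted (graft d p A)
    graft-sound sound zero    []      = sound
    graft-sound {A} sound (suc d) (i ∷ p) c {c′ , ts} x∈ with refl , ts∈ ← ∈-nodes⁻ c (graftChildren d i p A c) x∈ =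
      lookup⁻ (λ i′ → child-sound i′ (ts∈ i′)) , refl
      where
      ChildOk : Colouring (d + k) → Set
      ChildOk t = rootOf (d + k) t ≢ c × IsProper (d + k) t
      child-sound : ∀ i′ {t} → t ∈ graftChildren d i p A c i′ → ChildOk t
      child-sound i′ {t} = updateAt-elim (λ xs → t ∈ xs → ChildOk t) (const (colouringsAvoiding (d + k) c)) i i′
        (λ _ t∈ → let j , t∈ⱼ = ∈-concatFin⁻ (λ j → graft d p A (punchIn c j)) t∈
                      proper , t≡cⱼ = graft-sound sound d p (punchIn c j) t∈ⱼ
                  in (λ t≡c → punchInᵢ≢i c j (trans (sym t≡cⱼ) t≡c)) , proper)
        (λ _ t∈ → let proper , t≢c = colouringsAvoiding-sound (d + k) t∈ in t≢c , proper)

    unique-graft : ∀ {A} → AllProperRooted A → (∀ c → Unique (A c)) → ∀ d p c → Unique (graft d p A c)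
    unique-graft sound uniq zero    []      c = uniq c
    unique-graft {A} sound uniq (suc d) (i ∷ p) c = unique-nodes c (graftChildren d i p A c) λ i′ →
      updateAt-elim Unique (const (colouringsAvoiding (d + k) c)) i i′
        (λ _ → unique-concatFin (λ j → graft d p A (punchIn c j)) (λ j → unique-graft sound uniq d p (punchIn c j))
          λ j j′ x∈ x∈′ → punchIn-injective c j j′
            (trans (sym (proj₂ (graft-sound sound d p _ x∈))) (proj₂ (graft-sound sound d p _ x∈′))))
        (λ _ → unique-colouringsAvoiding (d + k) c)

    module _ (num den : ℕ) where
      open Ratio num den

      length-graft-≼ : ∀ {A B} → (∀ c → length (A c) ≼ length (B c)) →
                       ∀ d p c → length (graft d p A c) ≼ length (graft d p B c)
      length-graft-≼ A≼B zero    []      c = A≼B c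
      length-graft-≼ {A} {B} A≼B (suc d) (i ∷ p) c =
        subst₂ _≼_ (sym (length-nodes c (graftChildren d i p A c))) (sym (length-nodes c (graftChildren d i p B c)))
          (∏-≼-except i at-i (λ i′ i′≢i → trans (cong length (updateAt-minimal i′ i _ i′≢i))
                                                 (sym (cong length (updateAt-minimal i′ i _ i′≢i)))))
        where
        at-i : length (graftChildren d i p A c i) ≼ length (graftChildren d i p B c i)
        at-i = subst₂ _≼_
          (sym (trans (cong length (updateAt-updates i _)) (length-concatFin (λ j → graft d p A (punchIn c j)))))
          (sym (trans (cong length (updateAt-updates i _)) (length-concatFin (λ j → graft d p B (punchIn c j)))))
          (∑-≼ {f = λ j → length (graft d p A (punchIn c j))} {g = λ j → length (graft d p B (punchIn c j))}
            (λ j → length-graft-≼ A≼B d p (punchIn c j)))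

    grafts : ∀ d → Vec (Fin b) d → (Fin q → List (Colouring k)) → List (Colouring (d + k))
    grafts d p A = concatFin (graft d p A)

    ∈-grafts : ∀ (Q : Colouring k → Set) {A} → (∀ {s} → IsProper k s → Q s → s ∈ A (rootOf k s)) →
               ∀ d p {x} → IsProper (d + k) x → Q (subAt d p x) → x ∈ grafts d p A
    ∈-grafts Q {A} complete d p {x} proper Qx =
      ∈-concatFin⁺ (graft d p A) (rootOf (d + k) x) (∈-graft Q complete d p proper Qx)

    grafts-proper : ∀ {A} → AllProperRooted A → ∀ d p {x} → x ∈ grafts d p A → IsProper (d + k) x
    grafts-proper {A} sound d p x∈ with c , x∈c ← ∈-concatFin⁻ (graft d p A) x∈ = proj₁ (graft-sound sound d p c x∈c)

    unique-grafts : ∀ {A} → AllProperRooted A → (∀ c → Unique (A c)) → ∀ d p → Unique (grafts d p A)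
    unique-grafts {A} sound uniq d p = unique-concatFin (graft d p A) (unique-graft sound uniq d p)
      λ c c′ x∈ x∈′ → trans (sym (proj₂ (graft-sound sound d p c x∈))) (proj₂ (graft-sound sound d p c′ x∈′))

    module _ (num den : ℕ) where
      open Ratio num den

      length-grafts-≼ : ∀ {A B} → (∀ c → length (A c) ≼ length (B c)) →
                        ∀ d p → length (grafts d p A) ≼ length (grafts d p B)
      length-grafts-≼ {A} {B} A≼B d p =
        subst₂ _≼_ (sym (length-concatFin (graft d p A))) (sym (length-concatFin (graft d p B)))
          (∑-≼ {f = length ∘ graft d p A} {g = length ∘ graft d p B} (length-graft-≼ num den A≼B d p))

module LooseBound (β γ : ℕ) (b^2q≤eᵇ : (2 + β) ^ (2 * (3 + γ)) ≤e^ (2 + β)) where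

  open Parameters β γ
  open Enumeration (suc β) (suc γ) hiding (b; q; q′)

  private
    instance
      bᵇ≢0 : NonZero ((1 + β) ^ b)
      bᵇ≢0 = m^n≢0 (1 + β) b

  permitting-ratio : ∀ h → #unforced h * (1 + β) ≤ #colourings h → #permitting h * (1 + β) ≤ #colourings h * K
  permitting-ratio h unforced≤ = begin
    (#unforced h + suc γ * P) * (1 + β)          ≡⟨ *-distribʳ-+ (1 + β) (#unforced h) _ ⟩
    #unforced h * (1 + β) + suc γ * P * (1 + β)  ≤⟨ +-monoˡ-≤ _ unforced≤ ⟩
    P + suc γ * P * (1 + β)                      ≡⟨ expand P γ β ⟩
    P * K                                        ∎
    where
    open ≤-Reasoning
    P : ℕ
    P = #colourings h
    expand : ∀ P γ β → P + (1 + γ) * P * (1 + β) ≡ P * ((1 + γ) * (1 + β) + 1)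
    expand = solve-∀

  unforced-ratio : ∀ h → #unforced h * (1 + β) ≤ #colourings h
  unforced-ratio zero    = z≤n
  unforced-ratio (suc h) = *-cancelʳ-≤ _ _ ((1 + β) ^ b) $ begin
    q′ * #permitting h ^ b * (1 + β) * (1 + β) ^ b     ≡⟨ regroup ⟩
    (1 + β) * q′ * (#permitting h * (1 + β)) ^ b
      ≤⟨ *-mono-≤ (≤-reflexive (sym D≡[b-1]q′)) (^-monoˡ-≤ b (permitting-ratio h (unforced-ratio h))) ⟩
    D * (P * K) ^ b                                    ≡⟨ cong (D *_) (^-distrib-* P K b) ⟩
    D * (P ^ b * K ^ b)                                ≡⟨ *-CS.x∙yz≈y∙xz D (P ^ b) (K ^ b) ⟩
    P ^ b * (D * K ^ b)                                ≤⟨ *-monoʳ-≤ (P ^ b) (D*K^b≤D^b b^2q≤eᵇ) ⟩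
    P ^ b * D ^ b                                      ≡⟨ ^-distrib-* P D b ⟨
    (P * D) ^ b                                        ≡⟨ cong (λ x → (P * x) ^ b) D≡[b-1]q′ ⟩
    (P * ((1 + β) * q′)) ^ b                           ≡⟨ cong (_^ b) (*-CS.x∙yz≈zx∙y P (1 + β) q′) ⟩
    (q′ * P * (1 + β)) ^ b                             ≡⟨ ^-distrib-* (q′ * P) (1 + β) b ⟩
    (q′ * P) ^ b * (1 + β) ^ b                         ∎
    where
    open ≤-Reasoning
    P : ℕ
    P = #colourings h
    regroup : q′ * #permitting h ^ b * (1 + β) * (1 + β) ^ b ≡ (1 + β) * q′ * (#permitting h * (1 + β)) ^ b
    regroup = trans (rearrange q′ (#permitting h ^ b) (1 + β) ((1 + β) ^ b))
                    (cong ((1 + β) * q′ *_) (sym (^-distrib-* (#permitting h) (1 + β) b)))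
      where
      rearrange : ∀ a x c y → a * x * c * y ≡ c * a * (x * y)
      rearrange = solve-∀

  open Ratio (q′ * K ^ (1 + β)) (D ^ (1 + β))

  loose-ratio : ∀ h c j → length (loose h c j) ≼ length (colourings (suc h) c)
  loose-ratio h c j = begin
    length (loose h c j) * D ^ (1 + β)           ≤⟨ *-monoˡ-≤ (D ^ (1 + β)) (length-loose h c j) ⟩
    q′ * (q′ * P * Pm ^ (1 + β)) * D ^ (1 + β)   ≡⟨ regroup ⟩
    q′ * (q′ * P) * (Pm * D) ^ (1 + β)           ≤⟨ *-monoʳ-≤ (q′ * (q′ * P)) (^-monoˡ-≤ (1 + β) Pm*D≤) ⟩
    q′ * (q′ * P) * (K * (q′ * P)) ^ (1 + β)     ≡⟨ cong (q′ * (q′ * P) *_) (^-distrib-* K (q′ * P) (1 + β)) ⟩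
    q′ * (q′ * P) * (K ^ (1 + β) * (q′ * P) ^ (1 + β)) ≡⟨ *-CS.interchange q′ (q′ * P) (K ^ (1 + β)) _ ⟩
    q′ * K ^ (1 + β) * #colourings (suc h)       ≡⟨ cong (q′ * K ^ (1 + β) *_) (length-colourings (suc h) c) ⟨
    q′ * K ^ (1 + β) * length (colourings (suc h) c) ∎
    where
    open ≤-Reasoning
    P : ℕ
    P = #colourings h
    Pm : ℕ
    Pm = #permitting h
    Pm*D≤ : Pm * D ≤ K * (q′ * P)
    Pm*D≤ = begin
      Pm * D               ≡⟨ cong (Pm *_) D≡[b-1]q′ ⟩
      Pm * ((1 + β) * q′)  ≡⟨ *-assoc Pm (1 + β) q′ ⟨
      Pm * (1 + β) * q′    ≤⟨ *-monoˡ-≤ q′ (permitting-ratio h (unforced-ratio h)) ⟩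
      P * K * q′           ≡⟨ rearrange P K q′ ⟩
      K * (q′ * P)         ∎
      where
      rearrange : ∀ P K q → P * K * q ≡ K * (q * P)
      rearrange = solve-∀
    regroup : q′ * (q′ * P * Pm ^ (1 + β)) * D ^ (1 + β) ≡ q′ * (q′ * P) * (Pm * D) ^ (1 + β)
    regroup = trans (rearrange q′ (q′ * P) (Pm ^ (1 + β)) (D ^ (1 + β)))
                    (cong (q′ * (q′ * P) *_) (sym (^-distrib-* Pm D (1 + β))))
      where
      rearrange : ∀ a x y z → a * (x * y) * z ≡ a * x * (y * z)
      rearrange = solve-∀

lemma9 : (b q : ℕ) → 2 ≤ b → 3 ≤ q → b ^ (2 * q) ≤e^ b →
    (d h : ℕ) (p : Vec (Fin b) d) (ℓ : Vec (Fin b) (suc h)) →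
    (L : List (Col b q (d + suc h))) → Unique L →
    All (λ x → Proper (d + suc h) x × Loose h (subAt d p x) ℓ) L →
    (Ω : List (Col b q (d + suc h))) → Unique Ω →
    All (Proper (d + suc h)) Ω →
    ((x : Col b q (d + suc h)) → Proper (d + suc h) x → x ∈ Ω) →
    (length L ^ (q ∸ 1)) ·e^ (b ∸ 2) ≤ (((q ∸ 1) * length Ω) ^ (q ∸ 1))
lemma9 _ _ (s≤s (s≤s (z≤n {β}))) (s≤s (s≤s (s≤s (z≤n {γ})))) b^2q≤eᵇ d h p ℓ L unique-L L-loose Ω unique-Ω _ Ω-complete =
  ·e^-from-ratio (length L) (length Ω) $ begin
    length L * den    ≤⟨ *-monoˡ-≤ den (⊆-unique⇒length-≤ unique-L L⊆E) ⟩
    length E * den    ≤⟨ length-grafts-≼ num den (λ c → loose-ratio h c (head ℓ)) d p ⟩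
    num * length Ω′   ≤⟨ *-monoʳ-≤ num (⊆-unique⇒length-≤ unique-Ω′ Ω′⊆Ω) ⟩
    num * length Ω    ∎
  where
  open ≤-Reasoning
  open Parameters β γ
  open LooseBound β γ b^2q≤eᵇ
  open Enumeration (suc β) (suc γ) hiding (b; q; q′)
  num den : ℕ
  num = q′ * K ^ (1 + β)
  den = D ^ (1 + β)
  E Ω′ : List (Colouring (d + suc h))
  E  = grafts d p (λ c → loose h c (head ℓ))
  Ω′ = grafts d p (colourings (suc h))
  sound : AllProperRooted (colourings (suc h))
  sound c = colourings-sound (suc h)
  L⊆E : L ⊆ E
  L⊆E x∈ = ∈-grafts (λ s → Loose h s ℓ) (∈-loose h ℓ) d p (proj₁ (All.lookup L-loose x∈)) (proj₂ (All.lookup L-loose x∈))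
  unique-Ω′ : Unique Ω′
  unique-Ω′ = unique-grafts sound (unique-colourings (suc h)) d p
  Ω′⊆Ω : Ω′ ⊆ Ω
  Ω′⊆Ω x∈ = Ω-complete _ (grafts-proper sound d p x∈)
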